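{- Let $b,c$ be positive integers and define $u_i^\varepsilon$ for $i\in\mathbb{Z}$, $\varepsilon\in\{+,-\}$ by $u_0^\varepsilon=0$, $u_1^\varepsilon=1$, $u_{i+1}^+=bu_i^--u_{i-1}^+$ and $u_{i+1}^-=cu_i^+-u_{i-1}^-$ for all $i\in\mathbb{Z}$. Then for all $i,\ell\in\mathbb{Z}$ and $\varepsilon\in\{\pm\}$, \[u_{i+\ell}^\varepsilon=\begin{cases}u_{\ell+1}^\varepsilon u_i^{ -\varepsilon}-u_\ell^{ -\varepsilon}u_{i-1}^\varepsilon & \text{if }\ell\text{ is odd;}\\ u_{\ell+1}^{ -\varepsilon}u_i^\varepsilon-u_\ell^\varepsilon u_{i-1}^{ -\varepsilon} & \text{if }\ell\text{ is even.}\end{cases}\]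
   Context: The recursion determines $u_i^\varepsilon$ for all $i\in\mathbb{Z}$ (forwards and backwards from $i=0,1$). Here $-\varepsilon$ denotes the opposite sign. -}

module Defs where

open import Data.Integer using (ℤ; +_; _+_; _-_; _*_; 0ℤ; 1ℤ)
open import Relation.Binary.PropositionalEquality using (_≡_)

data Sign : Set where
  plus minus : Sign

opp : Sign → Sign
opp plus  = minus
opp minus = plus

record IsUSeq (b c : ℤ) (u : Sign → ℤ → ℤ) : Set where
  field
    init0 : ∀ ε → u ε 0ℤ ≡ 0ℤ
    init1 : ∀ ε → u ε 1ℤ ≡ 1ℤ
    recP  : ∀ i → u plus  (i + 1ℤ) ≡ b * u minus i - u plus  (i - 1ℤ)
    recM  : ∀ i → u minus (i + 1ℤ) ≡ c * u plus  i - u minus (i - 1ℤ)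

-- As functions of i, both sides of the addition formula solve the recurrence system
-- of u: the left side is a shift of u, the right side a difference of u, its sign
-- swap and its shift by -1, each multiplied by a sign-dependent factor. Such a
-- product remains a solution when the factor is compatible with b and c, which is
-- what the parity relations c u⁺ⱼ = b u⁻ⱼ (j even) and u⁺ⱼ = u⁻ⱼ (j odd) provide.
-- A solution is determined by its values at 0 and 1, where both sides agree.
module Submission where

open import Defs
open import Data.Integer using (ℤ; +_; -[1+_]; _+_; _-_; _*_; 0ℤ; 1ℤ; -1ℤ; _>_)
open import Data.Integer.Divisibility using (_∣_)
import Data.Integer.Divisibility.Signed as Signed
open import Data.Integer.DivMod using (_%ℕ_; _/ℕ_; n%ℕd<d; a≡a%ℕn+[a/ℕn]*n)
open import Data.Integer.Properties using (+-comm; *-comm; *-zeroʳ; +-identityˡ; +-commutativeSemigroup)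
open import Data.Integer.Tactic.RingSolver using (solve-∀)
open import Algebra.Properties.CommutativeSemigroup +-commutativeSemigroup using (xy∙z≈xz∙y)
open import Data.Nat as ℕ using (s≤s)
import Data.Nat.Properties as ℕ
open import Data.Nat.Divisibility using (∣1⇒≡1)
open import Data.Product using (_×_; _,_; proj₁; proj₂; ∃-syntax)
open import Data.Sum using (_⊎_; inj₁; inj₂)
open import Data.Empty using (⊥-elim)
open import Relation.Nullary using (¬_)
open import Relation.Binary.PropositionalEquality
open ≡-Reasoning

ℤ-induction : (P : ℤ → Set) → P 0ℤ → (∀ i → P i → P (i + 1ℤ)) → (∀ i → P (i + 1ℤ) → P i) →
              ∀ i → P i
ℤ-induction P P0 up down (+ n)    = nonNegative n
  where
  nonNegative : ∀ n → P (+ n)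
  nonNegative ℕ.zero    = P0
  nonNegative (ℕ.suc n) = subst P (cong +_ (ℕ.+-comm n 1)) (up (+ n) (nonNegative n))
ℤ-induction P P0 up down -[1+ n ] = negative n
  where
  negative : ∀ n → P -[1+ n ]
  negative ℕ.zero    = down -1ℤ P0
  negative (ℕ.suc n) = down -[1+ ℕ.suc n ] (negative n)

even-or-odd : ∀ j → ∃[ m ] (j ≡ m * + 2 ⊎ j ≡ m * + 2 + 1ℤ)
even-or-odd j with j %ℕ 2 | n%ℕd<d j 2 | a≡a%ℕn+[a/ℕn]*n j 2
... | 0 | _ | j≡ = j /ℕ 2 , inj₁ (trans j≡ (+-identityˡ _))
... | 1 | _ | j≡ = j /ℕ 2 , inj₂ (trans j≡ (+-comm 1ℤ (j /ℕ 2 * + 2)))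
... | ℕ.suc (ℕ.suc _) | s≤s (s≤s ()) | _

2∣m*2 : ∀ m → + 2 ∣ m * + 2
2∣m*2 m = Signed.∣⇒∣ᵤ (Signed.∣n⇒∣m*n m Signed.∣-refl)

even⇒suc-odd : ∀ j → + 2 ∣ j → ¬ (+ 2 ∣ j + 1ℤ)
even⇒suc-odd j 2∣j 2∣j+1
  with ∣1⇒≡1 (Signed.∣⇒∣ᵤ (Signed.∣m+n∣m⇒∣n {+ 2} {j} {1ℤ} (Signed.∣ᵤ⇒∣ 2∣j+1) (Signed.∣ᵤ⇒∣ 2∣j)))
... | ()

odd⇒suc-even : ∀ j → ¬ (+ 2 ∣ j) → + 2 ∣ j + 1ℤ
odd⇒suc-even j 2∤j with even-or-odd j
... | m , inj₁ refl = ⊥-elim (2∤j (2∣m*2 m))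
... | m , inj₂ refl = subst (+ 2 ∣_) (double-suc m) (2∣m*2 (m + 1ℤ))
  where
  double-suc : ∀ m → (m + 1ℤ) * + 2 ≡ m * + 2 + 1ℤ + 1ℤ
  double-suc = solve-∀

record Solves (k : Sign → ℤ) (w : Sign → ℤ → ℤ) : Set where
  constructor solves
  field
    recurrence : ∀ ε i → w ε (i + 1ℤ) ≡ k ε * w (opp ε) i - w ε (i - 1ℤ)
open Solves

module _ {k : Sign → ℤ} where

  solves-forward : ∀ {w} → Solves k w → ∀ ε i →
                   w ε (i + 1ℤ + 1ℤ) ≡ k ε * w (opp ε) (i + 1ℤ) - w ε i
  solves-forward {w} sol ε i =
    trans (recurrence sol ε (i + 1ℤ)) (cong (λ j → k ε * w (opp ε) (i + 1ℤ) - w ε j) (i+1-1≡i i))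
    where
    i+1-1≡i : ∀ i → i + 1ℤ - 1ℤ ≡ i
    i+1-1≡i = solve-∀

  solves-backward : ∀ {w} → Solves k w → ∀ ε i →
                    w ε i ≡ k ε * w (opp ε) (i + 1ℤ) - w ε (i + 1ℤ + 1ℤ)
  solves-backward {w} sol ε i = begin
    w ε i                                   ≡⟨ x≡a-[a-x] (k ε * w (opp ε) (i + 1ℤ)) (w ε i) ⟩
    K - (K - w ε i)                         ≡⟨ cong (λ t → K - t) (solves-forward sol ε i) ⟨
    K - w ε (i + 1ℤ + 1ℤ)                   ∎
    where
    K = k ε * w (opp ε) (i + 1ℤ)
    x≡a-[a-x] : ∀ a x → x ≡ a - (a - x)
    x≡a-[a-x] = solve-∀

  solutions-agree : ∀ {v w} → Solves k v → Solves k w →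
                    (∀ ε → v ε 0ℤ ≡ w ε 0ℤ) → (∀ ε → v ε 1ℤ ≡ w ε 1ℤ) →
                    ∀ ε i → v ε i ≡ w ε i
  solutions-agree {v} {w} solv solw v0 v1 ε i =
    proj₁ (ℤ-induction AgreeTwice (v0 , v1) up down i) ε
    where
    Agree : ℤ → Set
    Agree i = ∀ ε → v ε i ≡ w ε i

    AgreeTwice : ℤ → Set
    AgreeTwice i = Agree i × Agree (i + 1ℤ)

    up : ∀ i → AgreeTwice i → AgreeTwice (i + 1ℤ)
    up i (p , q) = q , λ ε → begin
      v ε (i + 1ℤ + 1ℤ)                      ≡⟨ solves-forward solv ε i ⟩
      k ε * v (opp ε) (i + 1ℤ) - v ε i       ≡⟨ cong₂ (λ x y → k ε * x - y) (q (opp ε)) (p ε) ⟩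
      k ε * w (opp ε) (i + 1ℤ) - w ε i       ≡⟨ solves-forward solw ε i ⟨
      w ε (i + 1ℤ + 1ℤ)                      ∎

    down : ∀ i → AgreeTwice (i + 1ℤ) → AgreeTwice i
    down i (q , r) = (λ ε → begin
      v ε i                                           ≡⟨ solves-backward solv ε i ⟩
      k ε * v (opp ε) (i + 1ℤ) - v ε (i + 1ℤ + 1ℤ)    ≡⟨ cong₂ (λ x y → k ε * x - y) (q (opp ε)) (r ε) ⟩
      k ε * w (opp ε) (i + 1ℤ) - w ε (i + 1ℤ + 1ℤ)    ≡⟨ solves-backward solw ε i ⟨
      w ε i                                           ∎) , q

  solves-shift : ∀ {w} → Solves k w → ∀ ℓ → Solves k (λ ε i → w ε (i + ℓ))
  solves-shift {w} sol ℓ = solves λ ε i → begin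
    w ε (i + 1ℤ + ℓ)                            ≡⟨ cong (w ε) (xy∙z≈xz∙y i 1ℤ ℓ) ⟩
    w ε (i + ℓ + 1ℤ)                            ≡⟨ recurrence sol ε (i + ℓ) ⟩
    k ε * w (opp ε) (i + ℓ) - w ε (i + ℓ - 1ℤ)  ≡⟨ cong (λ j → k ε * w (opp ε) (i + ℓ) - w ε j) (xy∙z≈xz∙y i ℓ -1ℤ) ⟩
    k ε * w (opp ε) (i + ℓ) - w ε (i - 1ℤ + ℓ)  ∎

  solves-swap : ∀ {w} → Solves k w → Solves (λ ε → k (opp ε)) (λ ε → w (opp ε))
  solves-swap sol = solves λ where
    plus  → recurrence sol minus
    minus → recurrence sol plus

  solves-scale : ∀ {w} {k′ : Sign → ℤ} (s : Sign → ℤ) → Solves k w →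
                 (∀ ε → s ε * k ε ≡ k′ ε * s (opp ε)) → Solves k′ (λ ε i → s ε * w ε i)
  solves-scale {w} {k′} s sol compatible = solves λ ε i → begin
    s ε * w ε (i + 1ℤ)                              ≡⟨ cong (s ε *_) (recurrence sol ε i) ⟩
    s ε * (k ε * w (opp ε) i - w ε (i - 1ℤ))         ≡⟨ distrib (s ε) (k ε) _ _ ⟩
    s ε * k ε * w (opp ε) i - s ε * w ε (i - 1ℤ)     ≡⟨ cong (λ a → a * w (opp ε) i - _) (compatible ε) ⟩
    k′ ε * s (opp ε) * w (opp ε) i - s ε * w ε (i - 1ℤ) ≡⟨ reassoc (k′ ε) (s (opp ε)) _ _ ⟩
    k′ ε * (s (opp ε) * w (opp ε) i) - s ε * w ε (i - 1ℤ) ∎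
    where
    distrib : ∀ a b x y → a * (b * x - y) ≡ a * b * x - a * y
    distrib = solve-∀
    reassoc : ∀ a b x y → a * b * x - y ≡ a * (b * x) - y
    reassoc = solve-∀

  solves-sub : ∀ {v w} → Solves k v → Solves k w → Solves k (λ ε i → v ε i - w ε i)
  solves-sub {v} {w} solv solw = solves λ ε i → begin
    v ε (i + 1ℤ) - w ε (i + 1ℤ)                 ≡⟨ cong₂ _-_ (recurrence solv ε i) (recurrence solw ε i) ⟩
    (k ε * v (opp ε) i - v ε (i - 1ℤ)) - (k ε * w (opp ε) i - w ε (i - 1ℤ))
                                                ≡⟨ sub-linear (k ε) _ _ _ _ ⟩
    k ε * (v (opp ε) i - w (opp ε) i) - (v ε (i - 1ℤ) - w ε (i - 1ℤ)) ∎
    where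
    sub-linear : ∀ a x y x′ y′ → (a * x - y) - (a * x′ - y′) ≡ a * (x - x′) - (y - y′)
    sub-linear = solve-∀

  solves-scale-symmetric : ∀ {w} (s : Sign → ℤ) → Solves k w → s plus ≡ s minus →
                           Solves k (λ ε i → s ε * w ε i)
  solves-scale-symmetric s sol s⁺≡s⁻ = solves-scale s sol λ where
    plus  → trans (*-comm (s plus) _) (cong (k plus *_) s⁺≡s⁻)
    minus → trans (*-comm (s minus) _) (cong (k minus *_) (sym s⁺≡s⁻))

coeff : ℤ → ℤ → Sign → ℤ
coeff b c plus  = b
coeff b c minus = c

solves-scale-balanced : ∀ {b c w} (s : Sign → ℤ) → Solves (λ ε → coeff b c (opp ε)) w →
                        c * s plus ≡ b * s minus → Solves (coeff b c) (λ ε i → s ε * w ε i)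
solves-scale-balanced {b} {c} s sol balanced = solves-scale s sol λ where
  plus  → trans (*-comm (s plus) c) balanced
  minus → trans (*-comm (s minus) b) (sym balanced)

balanced-step : ∀ b c {x₀ y₀ x₁ y₁} → c * x₀ ≡ b * y₀ → x₁ ≡ y₁ →
                c * (b * y₁ - x₀) ≡ b * (c * x₁ - y₀)
balanced-step b c {x₀} {y₀} {x₁} {y₁} c*x₀≡b*y₀ x₁≡y₁ = begin
  c * (b * y₁ - x₀)      ≡⟨ distrib-swap c b y₁ x₀ ⟩
  b * (c * y₁) - c * x₀  ≡⟨ cong₂ (λ y t → b * (c * y) - t) (sym x₁≡y₁) c*x₀≡b*y₀ ⟩
  b * (c * x₁) - b * y₀  ≡⟨ factor b (c * x₁) y₀ ⟩
  b * (c * x₁ - y₀)      ∎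
  where
  distrib-swap : ∀ c b y x → c * (b * y - x) ≡ b * (c * y) - c * x
  distrib-swap = solve-∀
  factor : ∀ b x y → b * x - b * y ≡ b * (x - y)
  factor = solve-∀

b≡a*0-b*-1 : ∀ a b → b ≡ a * 0ℤ - b * -1ℤ
b≡a*0-b*-1 = solve-∀

a≡a*1-b*0 : ∀ a b → a ≡ a * 1ℤ - b * 0ℤ
a≡a*1-b*0 = solve-∀

module USequence {b c : ℤ} {u : Sign → ℤ → ℤ} (U : IsUSeq b c u) where
  open IsUSeq U

  u-solves : Solves (coeff b c) u
  u-solves = solves λ where
    plus  → recP
    minus → recM

  u-at-minus-one : ∀ ε → u ε -1ℤ ≡ -1ℤ
  u-at-minus-one ε = begin
    u ε -1ℤ                                  ≡⟨ solves-backward u-solves ε -1ℤ ⟩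
    coeff b c ε * u (opp ε) 0ℤ - u ε 1ℤ      ≡⟨ cong₂ (λ x y → coeff b c ε * x - y) (init0 (opp ε)) (init1 ε) ⟩
    coeff b c ε * 0ℤ - 1ℤ                    ≡⟨ a*0-1≡-1 (coeff b c ε) ⟩
    -1ℤ                                      ∎
    where
    a*0-1≡-1 : ∀ a → a * 0ℤ - 1ℤ ≡ -1ℤ
    a*0-1≡-1 = solve-∀

  Balanced : ℤ → Set
  Balanced j = c * u plus j ≡ b * u minus j

  Symmetric : ℤ → Set
  Symmetric j = u plus j ≡ u minus j

  symmetric-at : ∀ {j} → Symmetric j → ∀ ε → u ε j ≡ u (opp ε) j
  symmetric-at h plus  = h
  symmetric-at h minus = sym h

  BalancedThenSymmetric : ℤ → Set
  BalancedThenSymmetric j = Balanced j × Symmetric (j + 1ℤ)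

  balancedThenSymmetric-forward : ∀ {j} → BalancedThenSymmetric j →
                                  BalancedThenSymmetric (j + 1ℤ + 1ℤ)
  balancedThenSymmetric-forward {j} (bal , symm) = bal₂ , symm₃
    where
    fwd = solves-forward u-solves
    bal₂ : Balanced (j + 1ℤ + 1ℤ)
    bal₂ = begin
      c * u plus (j + 1ℤ + 1ℤ)                  ≡⟨ cong (c *_) (fwd plus j) ⟩
      c * (b * u minus (j + 1ℤ) - u plus j)     ≡⟨ balanced-step b c bal symm ⟩
      b * (c * u plus (j + 1ℤ) - u minus j)     ≡⟨ cong (b *_) (fwd minus j) ⟨
      b * u minus (j + 1ℤ + 1ℤ)                 ∎
    symm₃ : Symmetric (j + 1ℤ + 1ℤ + 1ℤ)
    symm₃ = trans (fwd plus (j + 1ℤ))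
                  (trans (cong₂ _-_ (sym bal₂) symm) (sym (fwd minus (j + 1ℤ))))

  balancedThenSymmetric-backward : ∀ {j} → BalancedThenSymmetric (j + 1ℤ + 1ℤ) →
                                   BalancedThenSymmetric j
  balancedThenSymmetric-backward {j} (bal₂ , symm₃) = bal , symm₁
    where
    bwd = solves-backward u-solves
    symm₁ : Symmetric (j + 1ℤ)
    symm₁ = trans (bwd plus (j + 1ℤ))
                  (trans (cong₂ _-_ (sym bal₂) symm₃) (sym (bwd minus (j + 1ℤ))))
    bal : Balanced j
    bal = begin
      c * u plus j                                ≡⟨ cong (c *_) (bwd plus j) ⟩
      c * (b * u minus (j + 1ℤ) - u plus (j + 1ℤ + 1ℤ)) ≡⟨ balanced-step b c bal₂ symm₁ ⟩
      b * (c * u plus (j + 1ℤ) - u minus (j + 1ℤ + 1ℤ)) ≡⟨ cong (b *_) (bwd minus j) ⟨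
      b * u minus j                               ∎

  balancedThenSymmetric-even : ∀ m → BalancedThenSymmetric (m * + 2)
  balancedThenSymmetric-even = ℤ-induction (λ m → BalancedThenSymmetric (m * + 2)) base
    (λ m h → subst BalancedThenSymmetric (sym (double-suc m)) (balancedThenSymmetric-forward h))
    (λ m h → balancedThenSymmetric-backward (subst BalancedThenSymmetric (double-suc m) h))
    where
    base : BalancedThenSymmetric 0ℤ
    base = trans (cong (c *_) (init0 plus))
                 (trans (*-zeroʳ c) (sym (trans (cong (b *_) (init0 minus)) (*-zeroʳ b))))
         , trans (init1 plus) (sym (init1 minus))
    double-suc : ∀ m → (m + 1ℤ) * + 2 ≡ m * + 2 + 1ℤ + 1ℤ
    double-suc = solve-∀

  balanced-even : ∀ j → + 2 ∣ j → Balanced j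
  balanced-even j 2∣j with Signed.∣ᵤ⇒∣ {+ 2} {j} 2∣j
  ... | Signed.divides m refl = proj₁ (balancedThenSymmetric-even m)

  symmetric-odd : ∀ j → ¬ (+ 2 ∣ j) → Symmetric j
  symmetric-odd j 2∤j with even-or-odd j
  ... | m , inj₁ refl = ⊥-elim (2∤j (2∣m*2 m))
  ... | m , inj₂ refl = proj₂ (balancedThenSymmetric-even m)

  addition-odd : ∀ {ℓ} → Symmetric ℓ → Balanced (ℓ + 1ℤ) → ∀ i ε →
                 u ε (i + ℓ) ≡ u ε (ℓ + 1ℤ) * u (opp ε) i - u (opp ε) ℓ * u ε (i - 1ℤ)
  addition-odd {ℓ} symℓ bal i ε =
    solutions-agree (solves-shift u-solves ℓ) rhs-solves at-zero at-one ε i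
    where
    rhs-solves : Solves (coeff b c) (λ ε i → u ε (ℓ + 1ℤ) * u (opp ε) i - u (opp ε) ℓ * u ε (i - 1ℤ))
    rhs-solves = solves-sub
      (solves-scale-balanced (λ ε → u ε (ℓ + 1ℤ)) (solves-swap u-solves) bal)
      (solves-scale-symmetric (λ ε → u (opp ε) ℓ) (solves-shift u-solves -1ℤ) (sym symℓ))
    at-zero : ∀ ε → u ε (0ℤ + ℓ) ≡ u ε (ℓ + 1ℤ) * u (opp ε) 0ℤ - u (opp ε) ℓ * u ε -1ℤ
    at-zero ε = begin
      u ε (0ℤ + ℓ)    ≡⟨ cong (u ε) (+-identityˡ ℓ) ⟩
      u ε ℓ           ≡⟨ symmetric-at symℓ ε ⟩
      u (opp ε) ℓ     ≡⟨ b≡a*0-b*-1 (u ε (ℓ + 1ℤ)) (u (opp ε) ℓ) ⟩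
      u ε (ℓ + 1ℤ) * 0ℤ - u (opp ε) ℓ * -1ℤ
                      ≡⟨ cong₂ (λ x y → u ε (ℓ + 1ℤ) * x - u (opp ε) ℓ * y) (init0 (opp ε)) (u-at-minus-one ε) ⟨
      u ε (ℓ + 1ℤ) * u (opp ε) 0ℤ - u (opp ε) ℓ * u ε -1ℤ ∎
    at-one : ∀ ε → u ε (1ℤ + ℓ) ≡ u ε (ℓ + 1ℤ) * u (opp ε) 1ℤ - u (opp ε) ℓ * u ε 0ℤ
    at-one ε = begin
      u ε (1ℤ + ℓ)    ≡⟨ cong (u ε) (+-comm 1ℤ ℓ) ⟩
      u ε (ℓ + 1ℤ)    ≡⟨ a≡a*1-b*0 (u ε (ℓ + 1ℤ)) (u (opp ε) ℓ) ⟩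
      u ε (ℓ + 1ℤ) * 1ℤ - u (opp ε) ℓ * 0ℤ
                      ≡⟨ cong₂ (λ x y → u ε (ℓ + 1ℤ) * x - u (opp ε) ℓ * y) (init1 (opp ε)) (init0 ε) ⟨
      u ε (ℓ + 1ℤ) * u (opp ε) 1ℤ - u (opp ε) ℓ * u ε 0ℤ ∎

  addition-even : ∀ {ℓ} → Balanced ℓ → Symmetric (ℓ + 1ℤ) → ∀ i ε →
                  u ε (i + ℓ) ≡ u (opp ε) (ℓ + 1ℤ) * u ε i - u ε ℓ * u (opp ε) (i - 1ℤ)
  addition-even {ℓ} bal symℓ+1 i ε =
    solutions-agree (solves-shift u-solves ℓ) rhs-solves at-zero at-one ε i
    where
    rhs-solves : Solves (coeff b c) (λ ε i → u (opp ε) (ℓ + 1ℤ) * u ε i - u ε ℓ * u (opp ε) (i - 1ℤ))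
    rhs-solves = solves-sub
      (solves-scale-symmetric (λ ε → u (opp ε) (ℓ + 1ℤ)) u-solves (sym symℓ+1))
      (solves-scale-balanced (λ ε → u ε ℓ) (solves-swap (solves-shift u-solves -1ℤ)) bal)
    at-zero : ∀ ε → u ε (0ℤ + ℓ) ≡ u (opp ε) (ℓ + 1ℤ) * u ε 0ℤ - u ε ℓ * u (opp ε) -1ℤ
    at-zero ε = begin
      u ε (0ℤ + ℓ)    ≡⟨ cong (u ε) (+-identityˡ ℓ) ⟩
      u ε ℓ           ≡⟨ b≡a*0-b*-1 (u (opp ε) (ℓ + 1ℤ)) (u ε ℓ) ⟩
      u (opp ε) (ℓ + 1ℤ) * 0ℤ - u ε ℓ * -1ℤ
                      ≡⟨ cong₂ (λ x y → u (opp ε) (ℓ + 1ℤ) * x - u ε ℓ * y) (init0 ε) (u-at-minus-one (opp ε)) ⟨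
      u (opp ε) (ℓ + 1ℤ) * u ε 0ℤ - u ε ℓ * u (opp ε) -1ℤ ∎
    at-one : ∀ ε → u ε (1ℤ + ℓ) ≡ u (opp ε) (ℓ + 1ℤ) * u ε 1ℤ - u ε ℓ * u (opp ε) 0ℤ
    at-one ε = begin
      u ε (1ℤ + ℓ)        ≡⟨ cong (u ε) (+-comm 1ℤ ℓ) ⟩
      u ε (ℓ + 1ℤ)        ≡⟨ symmetric-at symℓ+1 ε ⟩
      u (opp ε) (ℓ + 1ℤ)  ≡⟨ a≡a*1-b*0 (u (opp ε) (ℓ + 1ℤ)) (u ε ℓ) ⟩
      u (opp ε) (ℓ + 1ℤ) * 1ℤ - u ε ℓ * 0ℤ
                          ≡⟨ cong₂ (λ x y → u (opp ε) (ℓ + 1ℤ) * x - u ε ℓ * y) (init1 ε) (init0 (opp ε)) ⟨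
      u (opp ε) (ℓ + 1ℤ) * u ε 1ℤ - u ε ℓ * u (opp ε) 0ℤ ∎

lemma2p2 : (b c : ℤ) → b > 0ℤ → c > 0ℤ → (u : Sign → ℤ → ℤ) → IsUSeq b c u →
    ∀ (i ℓ : ℤ) (ε : Sign) →
      (¬ (+ 2 ∣ ℓ) → u ε (i + ℓ) ≡ u ε (ℓ + 1ℤ) * u (opp ε) i - u (opp ε) ℓ * u ε (i - 1ℤ))
      × (+ 2 ∣ ℓ → u ε (i + ℓ) ≡ u (opp ε) (ℓ + 1ℤ) * u ε i - u ε ℓ * u (opp ε) (i - 1ℤ))
lemma2p2 b c _ _ u U i ℓ ε =
    (λ 2∤ℓ → addition-odd (symmetric-odd ℓ 2∤ℓ) (balanced-even (ℓ + 1ℤ) (odd⇒suc-even ℓ 2∤ℓ)) i ε)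
  , (λ 2∣ℓ → addition-even (balanced-even ℓ 2∣ℓ) (symmetric-odd (ℓ + 1ℤ) (even⇒suc-odd ℓ 2∣ℓ)) i ε)
  where open USequence U
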